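{- Let $\mathcal{G}$ be a hereditary class of graphs that is closed under complementation. Then a graph $H$ is a forbidden induced subgraph for the edge-add class $\mathcal{G}^{+}$ if and only if $\overline{H}$ is a forbidden induced subgraph for the edge-apex class $\mathcal{G}^{ - }$.
   Context: All graphs are simple, finite and undirected; $\overline{G}$ denotes the complement of $G$. A class of graphs is hereditary if it is closed under taking induced subgraphs. For a hereditary class $\mathcal{G}$, a forbidden induced subgraph for $\mathcal{G}$ is a graph not in $\mathcal{G}$ all of whose proper induced subgraphs are in $\mathcal{G}$. A non-edge of $G$ is an edge of $\overline{G}$. The edge-add class $\mathcal{G}^{+}$ is the class of graphs $G$ such that $G\in\mathcal{G}$ or $G$ has a non-edge $e$ with $G+e\in\mathcal{G}$. The edge-apex class $\mathcal{G}^{ - }$ is the class of graphs $G$ such that $G\in\mathcal{G}$ or $G$ has an edge $e$ with $G-e\in\mathcal{G}$. -}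

module Defs where

open import Data.Nat using (ℕ; _<_)
open import Data.Fin using (Fin; _≟_)
open import Data.Bool using (Bool; true; false; not; if_then_else_; _∧_; _∨_)
open import Data.Empty using (⊥-elim)
open import Data.Product using (Σ; ∃; _×_; _,_)
open import Data.Sum using (_⊎_)
open import Relation.Nullary using (¬_; Dec; yes; no)
open import Relation.Nullary.Decidable using (⌊_⌋)
open import Relation.Binary.PropositionalEquality using (_≡_; _≢_; refl; cong)
import Relation.Binary.PropositionalEquality as ≡
open import Function.Definitions using (Injective)
open import Level using (Level; suc; _⊔_)

record Graph (n : ℕ) : Set where
  field
    adj    : Fin n → Fin n → Bool
    sym    : ∀ i j → adj i j ≡ adj j i
    irrefl : ∀ i → adj i i ≡ false
open Graph public

Class : (ℓ : Level) → Set (suc ℓ)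
Class ℓ = ∀ {n} → Graph n → Set ℓ

record InducedEmbedding {m n : ℕ} (H : Graph m) (G : Graph n) : Set where
  field
    f     : Fin m → Fin n
    inj   : Injective _≡_ _≡_ f
    pres  : ∀ i j → adj G (f i) (f j) ≡ adj H i j
open InducedEmbedding public

ProperInduced : {m n : ℕ} → Graph m → Graph n → Set
ProperInduced {m} {n} H G = (m < n) × InducedEmbedding H G

Hereditary : ∀ {ℓ} → Class ℓ → Set ℓ
Hereditary C = ∀ {m n} (H : Graph m) (G : Graph n) → InducedEmbedding H G → C G → C H

complAdj : ∀ {n} → Graph n → Fin n → Fin n → Bool
complAdj G i j with i ≟ j
... | yes _ = false
... | no  _ = not (adj G i j)

complAdj-sym : ∀ {n} (G : Graph n) i j → complAdj G i j ≡ complAdj G j i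
complAdj-sym G i j with i ≟ j | j ≟ i
... | yes _ | yes _ = refl
... | yes p | no q = ⊥-elim (q (≡.sym p))
... | no p | yes q = ⊥-elim (p (≡.sym q))
... | no _ | no _ = cong not (Graph.sym G i j)

complAdj-irrefl : ∀ {n} (G : Graph n) i → complAdj G i i ≡ false
complAdj-irrefl G i with i ≟ i
... | yes _ = refl
... | no p = ⊥-elim (p refl)

complement : ∀ {n} → Graph n → Graph n
complement G = record { adj = complAdj G ; sym = complAdj-sym G ; irrefl = complAdj-irrefl G }

isPair : ∀ {n} → Fin n → Fin n → Fin n → Fin n → Bool
isPair u v i j = (⌊ i ≟ u ⌋ ∧ ⌊ j ≟ v ⌋) ∨ (⌊ i ≟ v ⌋ ∧ ⌊ j ≟ u ⌋)

setAdj : ∀ {n} → Graph n → Bool → Fin n → Fin n → Fin n → Fin n → Bool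
setAdj G b u v i j = if isPair u v i j then b else adj G i j

isPair-sym : ∀ {n} (u v i j : Fin n) → isPair u v i j ≡ isPair u v j i
isPair-sym u v i j with i ≟ u | j ≟ v | i ≟ v | j ≟ u
... | yes _ | yes _ | yes _ | yes _ = refl
... | yes _ | yes _ | yes _ | no  _ = refl
... | yes _ | yes _ | no  _ | yes _ = refl
... | yes _ | yes _ | no  _ | no  _ = refl
... | yes _ | no  _ | yes _ | yes _ = refl
... | yes _ | no  _ | yes _ | no  _ = refl
... | yes _ | no  _ | no  _ | yes _ = refl
... | yes _ | no  _ | no  _ | no  _ = refl
... | no  _ | yes _ | yes _ | yes _ = refl
... | no  _ | yes _ | yes _ | no  _ = refl
... | no  _ | yes _ | no  _ | yes _ = refl
... | no  _ | yes _ | no  _ | no  _ = refl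
... | no  _ | no  _ | yes _ | yes _ = refl
... | no  _ | no  _ | yes _ | no  _ = refl
... | no  _ | no  _ | no  _ | yes _ = refl
... | no  _ | no  _ | no  _ | no  _ = refl

isPair-irrefl : ∀ {n} (u v i : Fin n) → u ≢ v → isPair u v i i ≡ false
isPair-irrefl u v i u≢v with i ≟ u | i ≟ v
... | yes p | yes q = ⊥-elim (u≢v (≡.trans (≡.sym p) q))
... | yes _ | no  _ = refl
... | no  _ | yes _ = refl
... | no  _ | no  _ = refl

setAdj-sym : ∀ {n} (G : Graph n) b u v i j → setAdj G b u v i j ≡ setAdj G b u v j i
setAdj-sym G b u v i j rewrite isPair-sym u v i j | Graph.sym G i j = refl

setAdj-irrefl : ∀ {n} (G : Graph n) b u v → u ≢ v → ∀ i → setAdj G b u v i i ≡ false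
setAdj-irrefl G b u v u≢v i rewrite isPair-irrefl u v i u≢v = Graph.irrefl G i

addEdge : ∀ {n} (G : Graph n) (u v : Fin n) → u ≢ v → Graph n
addEdge G u v p = record { adj = setAdj G true u v ; sym = setAdj-sym G true u v ; irrefl = setAdj-irrefl G true u v p }

deleteEdge : ∀ {n} (G : Graph n) (u v : Fin n) → u ≢ v → Graph n
deleteEdge G u v p = record { adj = setAdj G false u v ; sym = setAdj-sym G false u v ; irrefl = setAdj-irrefl G false u v p }

ClosedUnderComplement : ∀ {ℓ} → Class ℓ → Set ℓ
ClosedUnderComplement C = ∀ {n} (G : Graph n) → C G → C (complement G)

EdgeAdd : ∀ {ℓ} → Class ℓ → Class ℓ
EdgeAdd C G = C G ⊎ Σ _ λ u → Σ _ λ v → Σ (u ≢ v) λ p → (adj G u v ≡ false) × C (addEdge G u v p)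

EdgeApex : ∀ {ℓ} → Class ℓ → Class ℓ
EdgeApex C G = C G ⊎ Σ _ λ u → Σ _ λ v → Σ (u ≢ v) λ p → (adj G u v ≡ true) × C (deleteEdge G u v p)

Forbidden : ∀ {ℓ} → Class ℓ → ∀ {n} → Graph n → Set ℓ
Forbidden C {n} H = ¬ C H × (∀ {m} (K : Graph m) → ProperInduced K H → C K)

{-# OPTIONS --safe #-}
module Submission where

open import Defs hiding (sym)
open import Data.Nat using (ℕ)
open import Data.Fin using (Fin; _≟_)
open import Data.Bool using (Bool; true; false; not)
open import Data.Bool.Properties using (not-involutive)
open import Data.Empty using (⊥-elim)
open import Data.Product using (_,_)
open import Data.Sum using (inj₁; inj₂)
open import Function.Bundles using (_⇔_; mk⇔)
open import Level using (Level)
open import Relation.Nullary using (yes; no)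
open import Relation.Binary.PropositionalEquality
  using (_≡_; _≢_; refl; sym; trans; cong; module ≡-Reasoning)

-- Complementation maps induced subgraphs to induced subgraphs and turns G + e into
-- the complement of G minus e.  So, for a hereditary class closed under complements,
-- complementing a graph swaps membership in 𝒢⁺ and 𝒢⁻, and the minimal graphs
-- outside one class are exactly the complements of the minimal graphs outside the other.

-- G' is the complement of G.  Unlike `complement`, this relation is symmetric, so the
-- double complement never has to be identified with the original graph.
record Complementary {n} (G G' : Graph n) : Set where
  constructor complementary
  field
    adj-not : ∀ i j → i ≢ j → adj G' i j ≡ not (adj G i j)
open Complementary

private
  variable
    n : ℕ
    G G' G'' H H' K K' : Graph n

complementary-sym : Complementary G G' → Complementary G' G
complementary-sym {G = G} {G' = G'} c = complementary λ i j i≢j → begin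
  adj G i j              ≡⟨ sym (not-involutive (adj G i j)) ⟩
  not (not (adj G i j))  ≡⟨ cong not (sym (adj-not c i j i≢j)) ⟩
  not (adj G' i j)       ∎
  where open ≡-Reasoning

complement-complementary : (G : Graph n) → Complementary G (complement G)
complement-complementary G = complementary not-adj
  where
  not-adj : ∀ i j → i ≢ j → complAdj G i j ≡ not (adj G i j)
  not-adj i j i≢j with i ≟ j
  ... | yes i≡j = ⊥-elim (i≢j i≡j)
  ... | no  _   = refl

complementary-unique : Complementary G G' → Complementary G G'' → ∀ i j → adj G' i j ≡ adj G'' i j
complementary-unique {G' = G'} {G'' = G''} c c' i j with i ≟ j
... | yes refl = trans (irrefl G' i) (sym (irrefl G'' i))
... | no  i≢j  = trans (adj-not c i j i≢j) (sym (adj-not c' i j i≢j))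

complementary-embedding : Complementary K K' → Complementary H H' →
                          InducedEmbedding K H → InducedEmbedding K' H'
complementary-embedding {K = K} {K' = K'} {H = H} {H' = H'} cK cH e =
  record { f = f e ; inj = inj e ; pres = pres' }
  where
  open ≡-Reasoning
  pres' : ∀ i j → adj H' (f e i) (f e j) ≡ adj K' i j
  pres' i j with i ≟ j
  ... | yes refl = trans (irrefl H' (f e i)) (sym (irrefl K' i))
  ... | no  i≢j  = begin
    adj H' (f e i) (f e j)     ≡⟨ adj-not cH (f e i) (f e j) (λ fi≡fj → i≢j (inj e fi≡fj)) ⟩
    not (adj H (f e i) (f e j)) ≡⟨ cong not (pres e i j) ⟩
    not (adj K i j)            ≡⟨ sym (adj-not cK i j i≢j) ⟩
    adj K' i j                 ∎

setAdj-complementary : Complementary G G' → ∀ (b : Bool) (u v i j : Fin n) → i ≢ j →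
                       setAdj G' (not b) u v i j ≡ not (setAdj G b u v i j)
setAdj-complementary c b u v i j i≢j with isPair u v i j
... | true  = refl
... | false = adj-not c i j i≢j

addEdge-complementary : Complementary G G' → ∀ u v (u≢v : u ≢ v) →
                        Complementary (addEdge G u v u≢v) (deleteEdge G' u v u≢v)
addEdge-complementary c u v _ = complementary (setAdj-complementary c true u v)

deleteEdge-complementary : Complementary G G' → ∀ u v (u≢v : u ≢ v) →
                           Complementary (deleteEdge G u v u≢v) (addEdge G' u v u≢v)
deleteEdge-complementary c u v _ = complementary (setAdj-complementary c false u v)

module _ {ℓ : Level} {C : Class ℓ} (hereditary : Hereditary C) where

  Hereditary⇒resp-adj : (∀ i j → adj G i j ≡ adj G' i j) → C G → C G'
  Hereditary⇒resp-adj {G = G} {G' = G'} same = hereditary G' G id-embedding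
    where
    id-embedding : InducedEmbedding G' G
    id-embedding = record { f = λ i → i ; inj = λ i≡j → i≡j ; pres = same }

  module _ (closed : ClosedUnderComplement C) where

    closed-complementary : Complementary G G' → C G → C G'
    closed-complementary {G = G} c CG =
      Hereditary⇒resp-adj (complementary-unique (complement-complementary G) c) (closed G CG)

    EdgeAdd⇒EdgeApex : Complementary G G' → EdgeAdd C G → EdgeApex C G'
    EdgeAdd⇒EdgeApex c (inj₁ CG) = inj₁ (closed-complementary c CG)
    EdgeAdd⇒EdgeApex c (inj₂ (u , v , u≢v , nonedge , CG+uv)) =
      inj₂ (u , v , u≢v , trans (adj-not c u v u≢v) (cong not nonedge) ,
            closed-complementary (addEdge-complementary c u v u≢v) CG+uv)

    EdgeApex⇒EdgeAdd : Complementary G G' → EdgeApex C G → EdgeAdd C G'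
    EdgeApex⇒EdgeAdd c (inj₁ CG) = inj₁ (closed-complementary c CG)
    EdgeApex⇒EdgeAdd c (inj₂ (u , v , u≢v , edge , CG-uv)) =
      inj₂ (u , v , u≢v , trans (adj-not c u v u≢v) (cong not edge) ,
            closed-complementary (deleteEdge-complementary c u v u≢v) CG-uv)

Forbidden-complementary : ∀ {ℓ} {A B : Class ℓ} →
                          (∀ {n} {G G' : Graph n} → Complementary G G' → A G → B G') →
                          (∀ {n} {G G' : Graph n} → Complementary G G' → B G → A G') →
                          Complementary H H' → Forbidden A H → Forbidden B H'
Forbidden-complementary A⇒B B⇒A cH (H∉A , minimal) =
  (λ BH' → H∉A (B⇒A (complementary-sym cH) BH')) ,
  λ K (m<n , e) →
    let cK = complement-complementary K
    in A⇒B (complementary-sym cK)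
           (minimal (complement K) (m<n , complementary-embedding cK (complementary-sym cH) e))

proposition1p3 : ∀ {ℓ : Level} (C : Class ℓ) → Hereditary C → ClosedUnderComplement C →
                 ∀ {n : ℕ} (H : Graph n) → Forbidden (EdgeAdd C) H ⇔ Forbidden (EdgeApex C) (complement H)
proposition1p3 C hereditary closed H =
  mk⇔ (Forbidden-complementary add⇒apex apex⇒add cH)
      (Forbidden-complementary apex⇒add add⇒apex (complementary-sym cH))
  where
  cH : Complementary H (complement H)
  cH = complement-complementary H
  add⇒apex : ∀ {m} {G G' : Graph m} → Complementary G G' → EdgeAdd C G → EdgeApex C G'
  add⇒apex = EdgeAdd⇒EdgeApex hereditary closed
  apex⇒add : ∀ {m} {G G' : Graph m} → Complementary G G' → EdgeApex C G → EdgeAdd C G'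
  apex⇒add = EdgeApex⇒EdgeAdd hereditary closed
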